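{- Let $M=(E,r)$ be a matroid with $|E|=m$ and of rank at most $k$. Then $\min_{\sigma}\sum_{i=1}^m r(E_{i,\sigma})={k+1\choose 2}+k(m-k)$, the minimum over bijections $\sigma:E\to\{1,\dots,m\}$, if and only if $M$ is isomorphic to the uniform matroid $U_k^m$.
   Context: $E_{i,\sigma}=\{e\in E:\sigma(e)\le i\}$. The uniform matroid $U_k^m$ on an $m$-element set has rank function $r(A)=\min\{|A|,k\}$, i.e., its bases are all $k$-subsets. -}

module Defs where

open import Data.Nat using (ℕ; zero; suc; _+_; _*_; _∸_; _≤_; _⊓_; _<ᵇ_)
open import Data.Nat.Combinatorics using (_C_)
open import Data.Fin using (Fin; toℕ)
open import Data.Fin.Subset using (Subset; _⊆_; _∪_; _∩_; ∣_∣; ⊤)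
open import Data.Fin.Permutation using (Permutation′; _⟨$⟩ʳ_; _⟨$⟩ˡ_)
open import Data.Vec using (tabulate; lookup)
open import Data.List using (List; map; upTo)
open import Data.Nat.ListAction using (sum)
open import Data.Product using (Σ; ∃; _×_)
open import Relation.Binary.PropositionalEquality using (_≡_)

record Matroid (m : ℕ) : Set where
  field
    rank    : Subset m → ℕ
    bounded : ∀ A → rank A ≤ ∣ A ∣
    mono    : ∀ A B → A ⊆ B → rank A ≤ rank B
    submod  : ∀ A B → rank (A ∪ B) + rank (A ∩ B) ≤ rank A + rank B
open Matroid public

matroidRank : ∀ {m} → Matroid m → ℕ
matroidRank M = rank M ⊤

image : ∀ {m} → Permutation′ m → Subset m → Subset m
image φ A = tabulate (λ j → lookup A (φ ⟨$⟩ˡ j))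

uniformRank : (k m : ℕ) → Subset m → ℕ
uniformRank k m A = ∣ A ∣ ⊓ k

IsomorphicToRank : ∀ {m} → Matroid m → (Subset m → ℕ) → Set
IsomorphicToRank M r' = ∃ λ φ → ∀ A → r' (image φ A) ≡ rank M A

IsoUniform : ∀ {m} → Matroid m → (k : ℕ) → Set
IsoUniform {m} M k = IsomorphicToRank M (uniformRank k m)

-- Bijections σ : E → {1,…,m} are encoded as σ : Fin m ↔ Fin m, where the
-- value j : Fin m stands for j+1.  E_{i,σ} = {e : σ(e) ≤ i}, i.e.
-- {e : toℕ (σ e) < i}.
prefixSet : ∀ {m} → Permutation′ m → ℕ → Subset m
prefixSet σ i = tabulate (λ e → toℕ (σ ⟨$⟩ʳ e) <ᵇ i)

rankSum : ∀ {m} → Matroid m → Permutation′ m → ℕ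
rankSum {m} M σ = sum (map (λ i → rank M (prefixSet σ (suc i))) (upTo m))

MinRankSumIs : ∀ {m} → Matroid m → ℕ → Set
MinRankSumIs M c = (∃ λ σ → rankSum M σ ≡ c) × (∀ σ → c ≤ rankSum M σ)

bound : ℕ → ℕ → ℕ
bound k m = (suc k C 2) + k * (m ∸ k)

-- Since every rank is at most k, r(E_{i,σ}) ≤ min(i, k) for every prefix, so
-- every rank sum is at most Σ_{i=1}^m min(i, k) = (k+1 choose 2) + k(m-k).
-- The minimum therefore equals this bound exactly when every prefix of every
-- ordering has rank min(i, k); as every set A is a prefix of some ordering
-- (list A first), that says r(A) = min(|A|, k) for all A, i.e. M = U_k^m.
module Submission where

open import Defs
open import Data.Nat using (ℕ; _≤_)
open import Function.Bundles using (_⇔_)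

open import Data.Nat using (zero; suc; _+_; _*_; _<_; _⊓_; _<ᵇ_; z≤n; s≤s; s≤s⁻¹)
open import Data.Nat.Properties
open import Data.Nat.Combinatorics using (_C_; nC1≡n; nCk+nC[k+1]≡[n+1]C[k+1])
open import Data.Bool using (Bool; true; false; T)
open import Data.Fin using (Fin; zero; suc; toℕ; fromℕ<)
open import Data.Fin.Properties using (toℕ-fromℕ<) renaming (_≟_ to _≟ᶠ_)
open import Data.Fin.Subset using (Subset; _⊆_; ∣_∣; ⊤)
open import Data.Fin.Subset.Properties using (⊆⊤; ∣p∣≤n)
open import Data.Fin.Permutation using (Permutation′; _⟨$⟩ʳ_; id; flip; lift₀; transpose; _∘ₚ_)
import Data.Fin.Permutation.Components as PC
open import Data.Vec using ([]; _∷_; tabulate; lookup)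
open import Data.Vec.Properties using (tabulate∘lookup; lookup∘tabulate; []=⇒lookup; lookup⇒[]=)
open import Data.List using (map; upTo; [_]; _++_; _∷ʳ_)
open import Data.List.Properties using (upTo-∷ʳ; map-++)
open import Data.Nat.ListAction using (sum)
open import Data.Nat.ListAction.Properties using (sum-++)
open import Data.Product using (∃; _×_; _,_; proj₁; proj₂)
open import Data.Sum using (_⊎_; inj₁; inj₂)
open import Data.Empty using (⊥-elim)
open import Function.Base using (_∘_)
open import Function.Bundles using (Equivalence; mk⇔)
open import Relation.Nullary using (yes; no)
open import Relation.Binary.PropositionalEquality hiding ([_])
import Algebra.Properties.CommutativeMonoid.Sum as MonoidSum

open MonoidSum +-0-commutativeMonoid using () renaming (sum to ∑; sum-permute to ∑-permute)

indicator : Bool → ℕ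
indicator true  = 1
indicator false = 0

∣tabulate∣≡∑indicator : ∀ {n} (p : Fin n → Bool) → ∣ tabulate p ∣ ≡ ∑ (indicator ∘ p)
∣tabulate∣≡∑indicator {zero}  p = refl
∣tabulate∣≡∑indicator {suc n} p with p zero
... | true  = cong suc (∣tabulate∣≡∑indicator (p ∘ suc))
... | false = ∣tabulate∣≡∑indicator (p ∘ suc)

∣tabulate∘permute∣ : ∀ {n} (p : Fin n → Bool) (π : Permutation′ n) →
  ∣ tabulate (p ∘ (π ⟨$⟩ʳ_)) ∣ ≡ ∣ tabulate p ∣
∣tabulate∘permute∣ p π = begin
  ∣ tabulate (p ∘ (π ⟨$⟩ʳ_)) ∣   ≡⟨ ∣tabulate∣≡∑indicator (p ∘ (π ⟨$⟩ʳ_)) ⟩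
  ∑ (indicator ∘ p ∘ (π ⟨$⟩ʳ_))  ≡⟨ ∑-permute (indicator ∘ p) π ⟨
  ∑ (indicator ∘ p)              ≡⟨ ∣tabulate∣≡∑indicator p ⟨
  ∣ tabulate p ∣                 ∎
  where open ≡-Reasoning

∣image∣ : ∀ {m} (φ : Permutation′ m) (A : Subset m) → ∣ image φ A ∣ ≡ ∣ A ∣
∣image∣ φ A = trans (∣tabulate∘permute∣ (lookup A) (flip φ)) (cong ∣_∣ (tabulate∘lookup A))

∣initialSegment∣ : ∀ m j → j ≤ m → ∣ tabulate {n = m} (λ e → toℕ e <ᵇ j) ∣ ≡ j
∣initialSegment∣ zero    zero    _         = refl
∣initialSegment∣ (suc m) zero    _         = ∣initialSegment∣ m zero z≤n
∣initialSegment∣ (suc m) (suc j) (s≤s j≤m) = cong suc (∣initialSegment∣ m j j≤m)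

∣prefixSet∣ : ∀ {m} (σ : Permutation′ m) j → j ≤ m → ∣ prefixSet σ j ∣ ≡ j
∣prefixSet∣ {m} σ j j≤m =
  trans (∣tabulate∘permute∣ (λ e → toℕ e <ᵇ j) σ) (∣initialSegment∣ m j j≤m)

prefixSet⊆ : ∀ {m} (σ : Permutation′ m) j (A : Subset m) →
  (∀ e → toℕ (σ ⟨$⟩ʳ e) < j → lookup A e ≡ true) → prefixSet σ j ⊆ A
prefixSet⊆ σ j A listed {e} e∈prefix = lookup⇒[]= e A (listed e (<ᵇ⇒< _ _ isTrue))
  where
  isTrue : T (toℕ (σ ⟨$⟩ʳ e) <ᵇ j)
  isTrue = subst T (sym (trans (sym (lookup∘tabulate _ e)) ([]=⇒lookup e∈prefix))) _

transpose-zero-suc : ∀ {n} (c : Fin (suc n)) (t : Fin n) →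
  suc t ≡ c ⊎ PC.transpose zero c (suc t) ≡ suc t
transpose-zero-suc c t with suc t ≟ᶠ c
... | yes st≡c = inj₁ st≡c
... | no  _    = inj₂ refl

listFirst : ∀ {m} (A : Subset m) →
  ∃ λ (σ : Permutation′ m) → ∀ e → toℕ (σ ⟨$⟩ʳ e) < ∣ A ∣ → lookup A e ≡ true
listFirst []              = id , λ ()
listFirst (true ∷ A) with listFirst A
... | σ , listed = lift₀ σ , listed′
  where
  listed′ : ∀ e → toℕ (lift₀ σ ⟨$⟩ʳ e) < suc ∣ A ∣ → lookup (true ∷ A) e ≡ true
  listed′ zero    _ = refl
  listed′ (suc e) lt = listed e (s≤s⁻¹ lt)
-- An element outside A is sent to position ∣ A ∣, just after the elements of A.
listFirst {suc m} (false ∷ A) with listFirst A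
... | σ , listed = lift₀ σ ∘ₚ transpose zero c , listed′
  where
  c : Fin (suc m)
  c = fromℕ< (s≤s (∣p∣≤n A))
  listed′ : ∀ e → toℕ (PC.transpose zero c (lift₀ σ ⟨$⟩ʳ e)) < ∣ A ∣ →
            lookup (false ∷ A) e ≡ true
  listed′ zero lt = ⊥-elim (<-irrefl (toℕ-fromℕ< (s≤s (∣p∣≤n A))) lt)
  listed′ (suc e) lt with transpose-zero-suc c (σ ⟨$⟩ʳ e)
  ... | inj₁ σe≡c = listed e (≤-reflexive (trans (cong toℕ σe≡c) (toℕ-fromℕ< (s≤s (∣p∣≤n A)))))
  ... | inj₂ fixed = listed e (<-trans (n<1+n _) (subst (λ v → toℕ v < ∣ A ∣) fixed lt))

sumUpTo : (ℕ → ℕ) → ℕ → ℕ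
sumUpTo f n = sum (map f (upTo n))

sumUpTo-suc : ∀ f n → sumUpTo f (suc n) ≡ sumUpTo f n + f n
sumUpTo-suc f n = begin
  sum (map f (upTo (suc n)))         ≡⟨ cong (sum ∘ map f) (upTo-∷ʳ n) ⟨
  sum (map f (upTo n ∷ʳ n))          ≡⟨ cong sum (map-++ f (upTo n) [ n ]) ⟩
  sum (map f (upTo n) ++ [ f n ])    ≡⟨ sum-++ (map f (upTo n)) [ f n ] ⟩
  sumUpTo f n + (f n + 0)            ≡⟨ cong (sumUpTo f n +_) (+-identityʳ (f n)) ⟩
  sumUpTo f n + f n                  ∎
  where open ≡-Reasoning

sumUpTo-cong : ∀ f g n → (∀ i → i < n → f i ≡ g i) → sumUpTo f n ≡ sumUpTo g n
sumUpTo-cong f g zero    f≡g = refl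
sumUpTo-cong f g (suc n) f≡g = begin
  sumUpTo f (suc n)  ≡⟨ sumUpTo-suc f n ⟩
  sumUpTo f n + f n  ≡⟨ cong₂ _+_ (sumUpTo-cong f g n (λ i → f≡g i ∘ m<n⇒m<1+n)) (f≡g n ≤-refl) ⟩
  sumUpTo g n + g n  ≡⟨ sumUpTo-suc g n ⟨
  sumUpTo g (suc n)  ∎
  where open ≡-Reasoning

sumUpTo-mono : ∀ f g n → (∀ i → i < n → f i ≤ g i) → sumUpTo f n ≤ sumUpTo g n
sumUpTo-mono f g zero    f≤g = z≤n
sumUpTo-mono f g (suc n) f≤g = subst₂ _≤_ (sym (sumUpTo-suc f n)) (sym (sumUpTo-suc g n))
  (+-mono-≤ (sumUpTo-mono f g n (λ i → f≤g i ∘ m<n⇒m<1+n)) (f≤g n ≤-refl))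

+-mono-≤-tight : ∀ {a b c d} → a ≤ c → b ≤ d → c + d ≤ a + b → c ≤ a × d ≤ b
+-mono-≤-tight {a} {b} {c} {d} a≤c b≤d c+d≤a+b =
  +-cancelʳ-≤ d c a (≤-trans c+d≤a+b (+-monoʳ-≤ a b≤d)) ,
  +-cancelˡ-≤ c d b (≤-trans c+d≤a+b (+-monoˡ-≤ b a≤c))

sumUpTo-mono-tight : ∀ f g n → (∀ i → i < n → f i ≤ g i) →
  sumUpTo g n ≤ sumUpTo f n → ∀ i → i < n → f i ≡ g i
sumUpTo-mono-tight f g zero    _   _   _ ()
sumUpTo-mono-tight f g (suc n) f≤g g≤f i i<1+n = belowOrAt (m<1+n⇒m<n∨m≡n i<1+n)
  where
  f≤g′ : ∀ i → i < n → f i ≤ g i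
  f≤g′ i = f≤g i ∘ m<n⇒m<1+n
  reverse : sumUpTo g n ≤ sumUpTo f n × g n ≤ f n
  reverse = +-mono-≤-tight (sumUpTo-mono f g n f≤g′) (f≤g n ≤-refl)
    (subst₂ _≤_ (sumUpTo-suc g n) (sumUpTo-suc f n) g≤f)
  belowOrAt : i < n ⊎ i ≡ n → f i ≡ g i
  belowOrAt (inj₁ i<n) = sumUpTo-mono-tight f g n f≤g′ (proj₁ reverse) i i<n
  belowOrAt (inj₂ refl) = ≤-antisym (f≤g n ≤-refl) (proj₂ reverse)

sumUpTo-suc≡C2 : ∀ n → sumUpTo suc n ≡ suc n C 2
sumUpTo-suc≡C2 zero    = refl
sumUpTo-suc≡C2 (suc n) = begin
  sumUpTo suc (suc n)    ≡⟨ sumUpTo-suc suc n ⟩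
  sumUpTo suc n + suc n  ≡⟨ cong (_+ suc n) (sumUpTo-suc≡C2 n) ⟩
  suc n C 2 + suc n      ≡⟨ +-comm (suc n C 2) (suc n) ⟩
  suc n + suc n C 2      ≡⟨ cong (_+ suc n C 2) (nC1≡n (suc n)) ⟨
  suc n C 1 + suc n C 2  ≡⟨ nCk+nC[k+1]≡[n+1]C[k+1] (suc n) 1 ⟩
  suc (suc n) C 2        ∎
  where open ≡-Reasoning

sumUpTo-suc⊓ : ∀ k d → sumUpTo (λ i → suc i ⊓ k) (k + d) ≡ suc k C 2 + k * d
sumUpTo-suc⊓ k zero = begin
  sumUpTo f (k + 0)  ≡⟨ cong (sumUpTo f) (+-identityʳ k) ⟩
  sumUpTo f k        ≡⟨ sumUpTo-cong f suc k (λ i → m≤n⇒m⊓n≡m) ⟩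
  sumUpTo suc k      ≡⟨ sumUpTo-suc≡C2 k ⟩
  suc k C 2          ≡⟨ +-identityʳ _ ⟨
  suc k C 2 + 0      ≡⟨ cong (suc k C 2 +_) (*-zeroʳ k) ⟨
  suc k C 2 + k * 0  ∎
  where
  open ≡-Reasoning
  f : ℕ → ℕ
  f i = suc i ⊓ k
sumUpTo-suc⊓ k (suc d) = begin
  sumUpTo f (k + suc d)            ≡⟨ cong (sumUpTo f) (+-suc k d) ⟩
  sumUpTo f (suc (k + d))          ≡⟨ sumUpTo-suc f (k + d) ⟩
  sumUpTo f (k + d) + f (k + d)    ≡⟨ cong₂ _+_ (sumUpTo-suc⊓ k d) (m≥n⇒m⊓n≡n (m≤n⇒m≤1+n (m≤m+n k d))) ⟩
  (suc k C 2 + k * d) + k          ≡⟨ +-assoc (suc k C 2) (k * d) k ⟩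
  suc k C 2 + (k * d + k)          ≡⟨ cong (suc k C 2 +_) (+-comm (k * d) k) ⟩
  suc k C 2 + (k + k * d)          ≡⟨ cong (suc k C 2 +_) (*-suc k d) ⟨
  suc k C 2 + k * suc d            ∎
  where
  open ≡-Reasoning
  f : ℕ → ℕ
  f i = suc i ⊓ k

sumUpTo-suc⊓≡bound : ∀ k m → k ≤ m → sumUpTo (λ i → suc i ⊓ k) m ≡ bound k m
sumUpTo-suc⊓≡bound k m k≤m with m≤n⇒∃[o]m+o≡n k≤m
... | d , refl = trans (sumUpTo-suc⊓ k d) (cong (λ x → suc k C 2 + k * x) (sym (m+n∸m≡n k d)))

module _ {m} (M : Matroid m) (k : ℕ) where

  HasUniformRank : Set
  HasUniformRank = ∀ A → rank M A ≡ ∣ A ∣ ⊓ k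

  IsoUniform⇔HasUniformRank : IsoUniform M k ⇔ HasUniformRank
  IsoUniform⇔HasUniformRank = mk⇔
    (λ (φ , iso) A → trans (sym (iso A)) (cong (_⊓ k) (∣image∣ φ A)))
    (λ uniform → id , λ A → trans (cong (_⊓ k) (∣image∣ id A)) (sym (uniform A)))

  module _ (k≤m : k ≤ m) where

    hasUniformRank⇒rankSum≡bound : HasUniformRank → ∀ σ → rankSum M σ ≡ bound k m
    hasUniformRank⇒rankSum≡bound uniform σ = trans
      (sumUpTo-cong _ (λ i → suc i ⊓ k) m
        (λ i i<m → trans (uniform (prefixSet σ (suc i))) (cong (_⊓ k) (∣prefixSet∣ σ (suc i) i<m))))
      (sumUpTo-suc⊓≡bound k m k≤m)

    hasUniformRank⇒minRankSum : HasUniformRank → MinRankSumIs M (bound k m)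
    hasUniformRank⇒minRankSum uniform =
      (id , hasUniformRank⇒rankSum≡bound uniform id) ,
      (λ σ → ≤-reflexive (sym (hasUniformRank⇒rankSum≡bound uniform σ)))

  module _ (rankM≤k : matroidRank M ≤ k) where

    rank≤∣∣⊓k : ∀ A → rank M A ≤ ∣ A ∣ ⊓ k
    rank≤∣∣⊓k A = ⊓-glb (bounded M A) (≤-trans (mono M A ⊤ ⊆⊤) rankM≤k)

    prefixRank≤ : ∀ σ j → j ≤ m → rank M (prefixSet σ j) ≤ j ⊓ k
    prefixRank≤ σ j j≤m = subst (λ x → rank M (prefixSet σ j) ≤ x ⊓ k) (∣prefixSet∣ σ j j≤m)
      (rank≤∣∣⊓k (prefixSet σ j))

    module _ (k≤m : k ≤ m) where

      prefixRank-tight : ∀ σ → bound k m ≤ rankSum M σ → ∀ j → j ≤ m →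
        rank M (prefixSet σ j) ≡ j ⊓ k
      prefixRank-tight σ bound≤ zero    _   = n≤0⇒n≡0 (prefixRank≤ σ zero z≤n)
      prefixRank-tight σ bound≤ (suc i) i<m =
        sumUpTo-mono-tight _ (λ i → suc i ⊓ k) m (λ i → prefixRank≤ σ (suc i))
          (subst (_≤ rankSum M σ) (sym (sumUpTo-suc⊓≡bound k m k≤m)) bound≤) i i<m

      minRankSum⇒hasUniformRank : MinRankSumIs M (bound k m) → HasUniformRank
      minRankSum⇒hasUniformRank (_ , bound≤) A with listFirst A
      ... | σ , listed = ≤-antisym (rank≤∣∣⊓k A) (begin
        ∣ A ∣ ⊓ k                  ≡⟨ prefixRank-tight σ (bound≤ σ) ∣ A ∣ (∣p∣≤n A) ⟨
        rank M (prefixSet σ ∣ A ∣) ≤⟨ mono M _ A (prefixSet⊆ σ ∣ A ∣ A listed) ⟩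
        rank M A                   ∎)
        where open ≤-Reasoning

lemma1 : (m k : ℕ) → k ≤ m → (M : Matroid m) → matroidRank M ≤ k →
    MinRankSumIs M (bound k m) ⇔ IsoUniform M k
lemma1 m k k≤m M rankM≤k = mk⇔
  (from ∘ minRankSum⇒hasUniformRank M k rankM≤k k≤m)
  (hasUniformRank⇒minRankSum M k k≤m ∘ to)
  where open Equivalence (IsoUniform⇔HasUniformRank M k)
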